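{- For the significance vector $s=(0,0,1,2,\dotsc,n-1)$ (of length $n+1$, so the function takes an $n$-bit number $\sum_{i=0}^{n-1}2^i x_i$ together with an additional bit $t$ of significance $0$ and outputs the $(n+1)$-bit binary representation of $t+\sum_{i=0}^{n-1}2^ix_i$), the minimum size of a Boolean circuit over the full binary basis computing the corresponding bit adder satisfies $\operatorname{size}(\mathrm{BA}^{0,0,1,\dotsc,n-1}) \ge 2n-O(1)$.
   Context: A Boolean circuit over the full binary basis is a directed acyclic graph whose source nodes are labeled by input variables and the constants $0,1$, and whose other nodes have in-degree $2$ and are labeled by arbitrary binary Boolean operations; some gates are designated as outputs. The size of a circuit is its number of non-input gates, and $\operatorname{size}(f)$ is the minimum size of a circuit computing $f$. For $s\in\mathbb{Z}_{\ge0}^k$, the bit adder $\mathrm{BA}^s$ maps $(x_1,\dotsc,x_k)\in\{0,1\}^k$ to the bits of the binary representation of $\sum_{i=1}^k 2^{s_i}x_i$ (omitting bit positions that are identically zero). -}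

module Defs where

open import Data.Bool using (Bool; true; false)
open import Data.Nat using (ℕ; zero; suc; _+_; _*_; _^_; _%_; _≡ᵇ_; ⌊_/2⌋)
open import Data.Fin using (Fin; zero; suc; toℕ)
open import Data.Product using (_×_; _,_)

-- A reference to a node of a circuit with k input variables, available
-- to a gate that has g gates before it: an input variable, a constant
-- source node (0 or 1), or one of the earlier gates.
data Ref (k g : ℕ) : Set where
  input : Fin k → Ref k g
  const : Bool → Ref k g
  gate  : Fin g → Ref k g

-- A gate over the full binary basis: an arbitrary binary Boolean
-- operation applied to two earlier nodes.
Gate : ℕ → ℕ → Set
Gate k g = (Bool → Bool → Bool) × Ref k g × Ref k g

-- A circuit with k inputs and g (non-input) gates, listed in topological
-- order (gate number j may only use inputs, constants and gates < j).
-- Its size is g.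
data Circuit (k : ℕ) : ℕ → Set where
  []  : Circuit k 0
  _▷_ : ∀ {g} → Circuit k g → Gate k g → Circuit k (suc g)

gateVal : ∀ {k g} → Circuit k g → (Fin k → Bool) → Fin g → Bool
refVal  : ∀ {k g} → Circuit k g → (Fin k → Bool) → Ref k g → Bool

gateVal (C ▷ (op , a , b)) x zero    = op (refVal C x a) (refVal C x b)
gateVal (C ▷ _)            x (suc j) = gateVal C x j

refVal C x (input i) = x i
refVal C x (const b) = b
refVal C x (gate j)  = gateVal C x j

-- (Gate indices: `zero` is the most recently
-- added gate, `suc j` refers to the circuit before it. Since each gate of
-- `C ▷ (op , a , b)` only references nodes of C, acyclicity is built in.)

Computes : ∀ {k g m} → Circuit k g → (Fin m → Ref k g)
         → ((Fin k → Bool) → Fin m → Bool) → Set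
Computes C out f = ∀ x j → refVal C x (out j) ≡ f x j
  where open import Relation.Binary.PropositionalEquality using (_≡_)

sumFin : (n : ℕ) → (Fin n → ℕ) → ℕ
sumFin zero    f = 0
sumFin (suc n) f = f zero + sumFin n (λ i → f (suc i))

bval : Bool → ℕ
bval false = 0
bval true  = 1

bit : ℕ → ℕ → Bool
bit v zero    = (v % 2) ≡ᵇ 1
bit v (suc j) = bit ⌊ v /2⌋ j

weightedSum : ∀ {k} → (Fin k → ℕ) → (Fin k → Bool) → ℕ
weightedSum {k} s x = sumFin k (λ i → 2 ^ s i * bval (x i))

-- The significance vector s = (0,0,1,2,...,n-1) of length n+1:
-- input 0 is the extra bit t, input (1+i) is x_i of significance i.
sig : (n : ℕ) → Fin (suc n) → ℕ
sig n zero    = 0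
sig n (suc i) = toℕ i

-- BA^{0,0,1,...,n-1}: outputs the n+1 bits (positions 0..n) of
-- t + Σ_{i<n} 2^i x_i. These are exactly the bit positions that are not
-- identically zero (the sum ranges over 0..2^n).
BA : (n : ℕ) → (Fin (suc n) → Bool) → Fin (suc n) → Bool
BA n x j = bit (weightedSum (sig n) x) (toℕ j)

-- Gate elimination. On a subcube of the inputs call a gate degenerate if there it computes a
-- constant or a possibly negated input or earlier gate, and essential otherwise. At level r+1, where
-- only t and x_0, …, x_r are free, output bits r+1 and r compute x_r ∧ c and x_r ⊕ c, where the carry
-- c into position r ignores x_r and takes both values. Let A be the essential gate closest to the
-- inputs that depends on x_r. Its arguments reduce to x_r or to functions ignoring x_r, so fixing
-- x_r = 0 makes A degenerate. It also makes the essential gate S computing x_r ∧ c constant, and if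
-- S = A, the essential gate computing x_r ⊕ c degenerates instead. So level r has at least two
-- essential gates fewer than level r+1, and level n has at least 2n.

module Submission where

open import Defs
open import Data.Bool using (Bool; true; false; _∧_; _xor_)
open import Data.Bool.Properties using (∧-zeroʳ; xor-assoc; xor-same) renaming (_≟_ to _≟ᵇ_)
open import Data.Fin using (Fin; zero; suc; toℕ; fromℕ<; inject₁)
import Data.Fin as Fin
open import Data.Fin.Induction using (>-wellFounded)
open import Data.Fin.Properties using (all?; any?; _≟_; ≤∧≢⇒<; toℕ-fromℕ<; toℕ-inject₁)
open import Data.Nat using (ℕ; zero; suc; _+_; _*_; _^_; ⌊_/2⌋; _≤_; _<_; z≤n; s≤s; _≤?_; _<?_)
open import Data.Nat.Properties
  using ( +-assoc; +-suc; *-assoc; *-identityˡ; *-distribˡ-+; *-suc; *-zeroʳ; +-mono-≤; +-monoʳ-≤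
        ; ≤-refl; ≤-trans; ≤-reflexive; <⇒≤; <-irrefl; ≤⇒≯; ≮⇒≥; m≤n⇒m≤1+n; m<n⇒m<1+n; m≤m+n
        ; module ≤-Reasoning)
open import Data.Product using (Σ; Σ-syntax; ∃-syntax; _×_; _,_; proj₁; proj₂)
open import Data.Sum using (_⊎_; inj₁; inj₂; [_,_])
open import Data.Unit using (⊤; tt)
open import Data.Vec.Functional using (_∷_; tail; updateAt)
open import Data.Vec.Functional.Properties using (∷-cong; updateAt-updates; updateAt-minimal)
open import Function using (_∘_)
open import Induction.WellFounded using (Acc; acc)
open import Relation.Binary.PropositionalEquality
  using (_≡_; _≢_; _≗_; refl; sym; trans; cong; cong₂; module ≡-Reasoning)
open import Relation.Nullary using (Dec; yes; no; ¬_; ¬?; does; contradiction; _×-dec_; _⊎-dec_; _→-dec_)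
open import Relation.Nullary.Decidable using (map′; dec-true; dec-false)

-- Binary addition

sumFin-cong : ∀ m {u v : Fin m → ℕ} → (∀ i → u i ≡ v i) → sumFin m u ≡ sumFin m v
sumFin-cong zero    eq = refl
sumFin-cong (suc m) eq = cong₂ _+_ (eq zero) (sumFin-cong m (λ i → eq (suc i)))

sumFin-*ˡ : ∀ m k (u : Fin m → ℕ) → sumFin m (λ i → k * u i) ≡ k * sumFin m u
sumFin-*ˡ zero    k u = sym (*-zeroʳ k)
sumFin-*ˡ (suc m) k u = begin
  k * u zero + sumFin m (λ i → k * u (suc i)) ≡⟨ cong (k * u zero +_) (sumFin-*ˡ m k (λ i → u (suc i))) ⟩
  k * u zero + k * sumFin m (λ i → u (suc i)) ≡⟨ *-distribˡ-+ k (u zero) _ ⟨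
  k * sumFin (suc m) u                         ∎
  where open ≡-Reasoning

rippleValue : ∀ m → Bool → (Fin m → Bool) → ℕ
rippleValue m c x = bval c + sumFin m (λ i → 2 ^ toℕ i * bval (x i))

digit : ∀ m → (Fin m → Bool) → ℕ → Bool
digit zero    x j       = false
digit (suc m) x zero    = x zero
digit (suc m) x (suc j) = digit m (tail x) j

carry : ∀ m → Bool → (Fin m → Bool) → ℕ → Bool
carry m       c x zero    = c
carry zero    c x (suc j) = false
carry (suc m) c x (suc j) = carry m (x zero ∧ c) (tail x) j

half-adder : ∀ a c → bval c + bval a ≡ bval (a xor c) + 2 * bval (a ∧ c)
half-adder false false = refl
half-adder false true  = refl
half-adder true  false = refl
half-adder true  true  = refl

rippleValue-suc : ∀ m c x → rippleValue (suc m) c x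
                ≡ bval (x zero xor c) + 2 * rippleValue m (x zero ∧ c) (tail x)
rippleValue-suc m c x = begin
  bval c + (1 * bval (x zero) + sumFin m (λ i → 2 ^ suc (toℕ i) * bval (x (suc i))))
    ≡⟨ cong₂ (λ a s → bval c + (a + s)) (*-identityˡ _) (sumFin-cong m (λ i → *-assoc 2 (2 ^ toℕ i) (bval (x (suc i))))) ⟩
  bval c + (bval (x zero) + sumFin m (λ i → 2 * (2 ^ toℕ i * bval (x (suc i)))))
    ≡⟨ cong (λ s → bval c + (bval (x zero) + s)) (sumFin-*ˡ m 2 _) ⟩
  bval c + (bval (x zero) + 2 * S)
    ≡⟨ +-assoc (bval c) _ _ ⟨
  bval c + bval (x zero) + 2 * S
    ≡⟨ cong (_+ 2 * S) (half-adder (x zero) c) ⟩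
  bval (x zero xor c) + 2 * bval (x zero ∧ c) + 2 * S
    ≡⟨ +-assoc (bval (x zero xor c)) _ _ ⟩
  bval (x zero xor c) + (2 * bval (x zero ∧ c) + 2 * S)
    ≡⟨ cong (bval (x zero xor c) +_) (*-distribˡ-+ 2 (bval (x zero ∧ c)) S) ⟨
  bval (x zero xor c) + 2 * rippleValue m (x zero ∧ c) (tail x) ∎
  where
  open ≡-Reasoning
  S : ℕ
  S = sumFin m (λ i → 2 ^ toℕ i * bval (x (suc i)))

bit-zero-parity : ∀ b R → bit (bval b + 2 * R) zero ≡ b
bit-zero-parity false zero    = refl
bit-zero-parity true  zero    = refl
bit-zero-parity b     (suc R) rewrite *-suc 2 R | +-suc (bval b) (suc (2 * R)) | +-suc (bval b) (2 * R) =
  bit-zero-parity b R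

half-parity : ∀ b R → ⌊ bval b + 2 * R /2⌋ ≡ R
half-parity false zero    = refl
half-parity true  zero    = refl
half-parity b     (suc R) rewrite *-suc 2 R | +-suc (bval b) (suc (2 * R)) | +-suc (bval b) (2 * R) =
  cong suc (half-parity b R)

bit-0 : ∀ j → bit 0 j ≡ false
bit-0 zero    = refl
bit-0 (suc j) = bit-0 j

bit-rippleValue : ∀ m c x j → bit (rippleValue m c x) j ≡ digit m x j xor carry m c x j
bit-rippleValue zero    false x zero    = refl
bit-rippleValue zero    true  x zero    = refl
bit-rippleValue zero    false x (suc j) = bit-0 j
bit-rippleValue zero    true  x (suc j) = bit-0 j
bit-rippleValue (suc m) c     x zero    rewrite rippleValue-suc m c x =
  bit-zero-parity (x zero xor c) (rippleValue m (x zero ∧ c) (tail x))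
bit-rippleValue (suc m) c     x (suc j) rewrite rippleValue-suc m c x =
  trans (cong (λ v → bit v j) (half-parity (x zero xor c) (rippleValue m (x zero ∧ c) (tail x)))) (bit-rippleValue m (x zero ∧ c) (tail x) j)

digit-toℕ : ∀ m x (i : Fin m) → digit m x (toℕ i) ≡ x i
digit-toℕ (suc m) x zero    = refl
digit-toℕ (suc m) x (suc i) = digit-toℕ m (tail x) i

digit-vanishes : ∀ m x j → (∀ i → j ≤ toℕ i → x i ≡ false) → digit m x j ≡ false
digit-vanishes zero    x j       _     = refl
digit-vanishes (suc m) x zero    zeros = zeros zero z≤n
digit-vanishes (suc m) x (suc j) zeros = digit-vanishes m (tail x) j (λ i j≤i → zeros (suc i) (s≤s j≤i))

carry-suc : ∀ m c x j → carry m c x (suc j) ≡ digit m x j ∧ carry m c x j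
carry-suc zero    c x j       = refl
carry-suc (suc m) c x zero    = refl
carry-suc (suc m) c x (suc j) = carry-suc m (x zero ∧ c) (tail x) j

carry-cong : ∀ m c {x x'} j → (∀ i → toℕ i < j → x i ≡ x' i) → carry m c x j ≡ carry m c x' j
carry-cong m       c zero    _  = refl
carry-cong zero    c (suc j) _  = refl
carry-cong (suc m) c (suc j) eq rewrite eq zero (s≤s z≤n) =
  carry-cong m _ j (λ i i<j → eq (suc i) (s≤s i<j))

carry-false : ∀ m x j → carry m false x j ≡ false
carry-false m       x zero    = refl
carry-false zero    x (suc j) = refl
carry-false (suc m) x (suc j) rewrite ∧-zeroʳ (x zero) = carry-false m (tail x) j

carry-ones : ∀ m x j → j ≤ m → (∀ i → toℕ i < j → x i ≡ true) → carry m true x j ≡ true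
carry-ones m       x zero    _         _    = refl
carry-ones (suc m) x (suc j) (s≤s j≤m) ones rewrite ones zero (s≤s z≤n) =
  carry-ones m (tail x) j j≤m (λ i i<j → ones (suc i) (s≤s i<j))

-- Boolean functions on subcubes

Assignment : ℕ → Set
Assignment k = Fin k → Bool

Extensional : ∀ {k} → (Assignment k → Bool) → Set
Extensional f = ∀ {p q} → p ≗ q → f p ≡ f q

InCube : ∀ {k} → (Fin k → Bool) → Assignment k → Set
InCube free p = ∀ l → free l ≡ false → p l ≡ false

_≈[_]_ : ∀ {k} → (Assignment k → Bool) → (Fin k → Bool) → (Assignment k → Bool) → Set
f ≈[ free ] h = ∀ p → InCube free p → f p ≡ h p

∀-assignment? : ∀ k {Q : Assignment k → Set} → (∀ {p q} → p ≗ q → Q p → Q q) →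
                (∀ p → Dec (Q p)) → Dec (∀ p → Q p)
∀-assignment? zero    resp Q? with Q? (λ ())
... | yes q = yes λ p → resp (λ ()) q
... | no ¬q = no λ all → ¬q (all _)
∀-assignment? (suc k) {Q} resp Q?
  with ∀-assignment? k (λ eq → resp (∷-cong refl eq)) (λ v → Q? (false ∷ v))
     | ∀-assignment? k (λ eq → resp (∷-cong refl eq)) (λ v → Q? (true ∷ v))
... | yes all₀ | yes all₁ = yes λ p → resp (∷-cong refl λ _ → refl) (cases (p zero) (tail p))
  where
  cases : ∀ b v → Q (b ∷ v)
  cases false = all₀
  cases true  = all₁
... | no ¬all₀ | _        = no λ all → ¬all₀ (λ v → all (false ∷ v))
... | yes _    | no ¬all₁ = no λ all → ¬all₁ (λ v → all (true ∷ v))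

inCube? : ∀ {k} (free : Fin k → Bool) p → Dec (InCube free p)
inCube? free p = all? (λ l → (free l ≟ᵇ false) →-dec (p l ≟ᵇ false))

≈? : ∀ {k} (free : Fin k → Bool) {f h : Assignment k → Bool} → Extensional f → Extensional h →
     Dec (f ≈[ free ] h)
≈? {k} free {f} {h} f-ext h-ext =
  ∀-assignment? k transport (λ p → inCube? free p →-dec (f p ≟ᵇ h p))
  where
  transport : ∀ {p q} → p ≗ q → (InCube free p → f p ≡ h p) → InCube free q → f q ≡ h q
  transport {p} {q} eq agree q∈ =
    trans (sym (f-ext eq)) (trans (agree (λ l fixed → trans (eq l) (q∈ l fixed))) (h-ext eq))

gateVal-extensional : ∀ {k g} (C : Circuit k g) j → Extensional (λ p → gateVal C p j)
refVal-extensional  : ∀ {k g} (C : Circuit k g) r → Extensional (λ p → refVal C p r)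
gateVal-extensional (C ▷ (op , a , b)) zero    eq =
  cong₂ op (refVal-extensional C a eq) (refVal-extensional C b eq)
gateVal-extensional (C ▷ _)            (suc j) eq = gateVal-extensional C j eq
refVal-extensional C (input i) eq = eq i
refVal-extensional C (const b) eq = refl
refVal-extensional C (gate j)  eq = gateVal-extensional C j eq

-- Gates with larger numbers are closer to the inputs, so lo ≤ʳ r says that r lies at least lo
-- gates before the newest one.
_≤ʳ_ : ∀ {k g} → ℕ → Ref k g → Set
lo ≤ʳ input _ = ⊤
lo ≤ʳ const _ = ⊤
lo ≤ʳ gate j  = lo ≤ toℕ j

≤ʳ-trans : ∀ {k g lo lo'} → lo ≤ lo' → (r : Ref k g) → lo' ≤ʳ r → lo ≤ʳ r
≤ʳ-trans le (input _) _   = tt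
≤ʳ-trans le (const _) _   = tt
≤ʳ-trans le (gate _)  le' = ≤-trans le le'

0≤ʳ : ∀ {k g} (r : Ref k g) → 0 ≤ʳ r
0≤ʳ (input _) = tt
0≤ʳ (const _) = tt
0≤ʳ (gate _)  = z≤n

weaken : ∀ {k g} → Ref k g → Ref k (suc g)
weaken (input i) = input i
weaken (const b) = const b
weaken (gate j)  = gate (suc j)

refVal-weaken : ∀ {k g} (C : Circuit k g) G p r → refVal (C ▷ G) p (weaken r) ≡ refVal C p r
refVal-weaken C G p (input i) = refl
refVal-weaken C G p (const b) = refl
refVal-weaken C G p (gate j)  = refl

≤ʳ-weaken : ∀ {k g} lo (r : Ref k g) → lo ≤ʳ r → suc lo ≤ʳ weaken r
≤ʳ-weaken lo (input i) _  = tt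
≤ʳ-weaken lo (const b) _  = tt
≤ʳ-weaken lo (gate j)  le = s≤s le

gate-inputs : ∀ {k g} (C : Circuit k g) (j : Fin g) →
  Σ[ op ∈ (Bool → Bool → Bool) ] Σ[ a ∈ Ref k g ] Σ[ b ∈ Ref k g ]
    suc (toℕ j) ≤ʳ a × suc (toℕ j) ≤ʳ b × (∀ p → gateVal C p j ≡ op (refVal C p a) (refVal C p b))
gate-inputs (C ▷ (op , a , b)) zero =
  op , weaken a , weaken b , ≤ʳ-weaken 0 a (0≤ʳ a) , ≤ʳ-weaken 0 b (0≤ʳ b) ,
  λ p → sym (cong₂ op (refVal-weaken C _ p a) (refVal-weaken C _ p b))
gate-inputs (C ▷ G) (suc j) with gate-inputs C j
... | op , a , b , a≤ , b≤ , eq = op , weaken a , weaken b , ≤ʳ-weaken _ a a≤ , ≤ʳ-weaken _ b b≤ ,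
  λ p → trans (eq p) (sym (cong₂ op (refVal-weaken C G p a) (refVal-weaken C G p b)))

-- Counting

count : ∀ n {P : Fin n → Set} → (∀ i → Dec (P i)) → ℕ
count n P? = sumFin n (λ i → bval (does (P? i)))

indicator-mono : ∀ {P Q : Set} (P? : Dec P) (Q? : Dec Q) → (Q → P) → bval (does Q?) ≤ bval (does P?)
indicator-mono P?        (no _)  Q⇒P = z≤n
indicator-mono (yes _)   (yes _) Q⇒P = ≤-refl
indicator-mono (no ¬p)   (yes q) Q⇒P = contradiction (Q⇒P q) ¬p

indicator-gap : ∀ {P Q : Set} (P? : Dec P) (Q? : Dec Q) → P → ¬ Q → suc (bval (does Q?)) ≤ bval (does P?)
indicator-gap P? Q? p ¬q rewrite dec-true P? p | dec-false Q? ¬q = ≤-refl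

count-≤ : ∀ n {P : Fin n → Set} (P? : ∀ i → Dec (P i)) → count n P? ≤ n
count-≤ zero    P? = z≤n
count-≤ (suc n) P? = +-mono-≤ (bval≤1 (does (P? zero))) (count-≤ n (λ i → P? (suc i)))
  where
  bval≤1 : ∀ b → bval b ≤ 1
  bval≤1 false = z≤n
  bval≤1 true  = s≤s z≤n

count-mono : ∀ n {P Q : Fin n → Set} (P? : ∀ i → Dec (P i)) (Q? : ∀ i → Dec (Q i)) →
             (∀ i → Q i → P i) → count n Q? ≤ count n P?
count-mono zero    P? Q? Q⇒P = z≤n
count-mono (suc n) P? Q? Q⇒P = +-mono-≤ (indicator-mono (P? zero) (Q? zero) (Q⇒P zero))
  (count-mono n (λ i → P? (suc i)) (λ i → Q? (suc i)) (λ i → Q⇒P (suc i)))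

count-gap : ∀ n {P Q : Fin n → Set} (P? : ∀ i → Dec (P i)) (Q? : ∀ i → Dec (Q i)) →
            (∀ i → Q i → P i) → ∀ i → P i → ¬ Q i → suc (count n Q?) ≤ count n P?
count-gap (suc n) P? Q? Q⇒P zero    p ¬q = +-mono-≤ (indicator-gap (P? zero) (Q? zero) p ¬q)
  (count-mono n (λ i → P? (suc i)) (λ i → Q? (suc i)) (λ i → Q⇒P (suc i)))
count-gap (suc n) P? Q? Q⇒P (suc i) p ¬q = ≤-trans (≤-reflexive (sym (+-suc _ _)))
  (+-mono-≤ (indicator-mono (P? zero) (Q? zero) (Q⇒P zero))
            (count-gap n (λ i → P? (suc i)) (λ i → Q? (suc i)) (λ i → Q⇒P (suc i)) i p ¬q))

count-gap₂ : ∀ n {P Q : Fin n → Set} (P? : ∀ i → Dec (P i)) (Q? : ∀ i → Dec (Q i)) →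
             (∀ i → Q i → P i) → ∀ i j → i ≢ j → P i → ¬ Q i → P j → ¬ Q j →
             2 + count n Q? ≤ count n P?
count-gap₂ (suc n) P? Q? Q⇒P zero zero i≢j _ _ _ _ = contradiction refl i≢j
count-gap₂ (suc n) P? Q? Q⇒P zero (suc j) _ pi ¬qi pj ¬qj =
  ≤-trans (≤-reflexive (cong suc (sym (+-suc _ _))))
    (+-mono-≤ (indicator-gap (P? zero) (Q? zero) pi ¬qi)
              (count-gap n (λ i → P? (suc i)) (λ i → Q? (suc i)) (λ i → Q⇒P (suc i)) j pj ¬qj))
count-gap₂ (suc n) P? Q? Q⇒P (suc i) zero _ pi ¬qi pj ¬qj =
  ≤-trans (≤-reflexive (cong suc (sym (+-suc _ _))))
    (+-mono-≤ (indicator-gap (P? zero) (Q? zero) pj ¬qj)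
              (count-gap n (λ i → P? (suc i)) (λ i → Q? (suc i)) (λ i → Q⇒P (suc i)) i pi ¬qi))
count-gap₂ (suc n) P? Q? Q⇒P (suc i) (suc j) i≢j pi ¬qi pj ¬qj =
  ≤-trans (≤-reflexive (sym (trans (+-suc _ _) (cong suc (+-suc _ _)))))
    (+-mono-≤ (indicator-mono (P? zero) (Q? zero) (Q⇒P zero))
              (count-gap₂ n (λ i → P? (suc i)) (λ i → Q? (suc i)) (λ i → Q⇒P (suc i)) i j
                          (λ eq → i≢j (cong suc eq)) pi ¬qi pj ¬qj))

maximal-witness : ∀ {n} {P : Fin n → Set} → (∀ i → Dec (P i)) → ∀ {i} → P i →
         Σ[ A ∈ Fin n ] P A × (∀ j → A Fin.< j → ¬ P j)
maximal-witness {P = P} P? {i} pi = go i (>-wellFounded i) pi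
  where
  go : ∀ i → Acc Fin._>_ i → P i → Σ[ A ∈ _ ] P A × (∀ j → A Fin.< j → ¬ P j)
  go i (acc rec) pi with any? (λ j → (toℕ i <? toℕ j) ×-dec P? j)
  ... | no none             = i , pi , λ j i<j pj → none (j , i<j , pj)
  ... | yes (j , i<j , pj) = go j (rec i<j) pj

-- Degenerate and essential gates

unary-cases : ∀ (U : Bool → Bool) → (Σ[ b ∈ Bool ] ∀ v → U v ≡ b) ⊎ (Σ[ s ∈ Bool ] ∀ v → U v ≡ s xor v)
unary-cases U with U false in u₀ | U true in u₁
... | false | false = inj₁ (false , λ { false → u₀ ; true → u₁ })
... | true  | true  = inj₁ (true  , λ { false → u₀ ; true → u₁ })
... | false | true  = inj₂ (false , λ { false → u₀ ; true → u₁ })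
... | true  | false = inj₂ (true  , λ { false → u₀ ; true → u₁ })

∃-bool? : ∀ {P : Bool → Set} → (∀ b → Dec (P b)) → Dec (Σ Bool P)
∃-bool? P? = map′ [ (false ,_) , (true ,_) ] (λ { (false , p) → inj₁ p ; (true , p) → inj₂ p })
                  (P? false ⊎-dec P? true)

∀-bool? : ∀ {P : Bool → Set} → (∀ b → Dec (P b)) → Dec (∀ b → P b)
∀-bool? P? = map′ (λ { (p₀ , p₁) false → p₀ ; (p₀ , p₁) true → p₁ }) (λ all → all false , all true)
                  (P? false ×-dec P? true)

∃-ref? : ∀ {k g} {P : Ref k g → Set} → (∀ r → Dec (P r)) → Dec (Σ (Ref k g) P)
∃-ref? P? = map′ [ (λ (i , p) → input i , p) , [ (λ (b , p) → const b , p) , (λ (j , p) → gate j , p) ] ]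
                 (λ { (input i , p) → inj₁ (i , p) ; (const b , p) → inj₂ (inj₁ (b , p))
                    ; (gate j , p) → inj₂ (inj₂ (j , p)) })
                 (any? (P? ∘ input) ⊎-dec ∃-bool? (P? ∘ const) ⊎-dec any? (P? ∘ gate))

_≤ʳ?_ : ∀ {k g} lo (r : Ref k g) → Dec (lo ≤ʳ r)
lo ≤ʳ? input _ = yes tt
lo ≤ʳ? const _ = yes tt
lo ≤ʳ? gate j  = lo ≤? toℕ j

module GateElimination {k g : ℕ} (C : Circuit k g) where

  node : Ref k g → Assignment k → Bool
  node r p = refVal C p r

  Degenerate : (Fin k → Bool) → Fin g → Set
  Degenerate free j =
    Σ[ s ∈ Bool ] Σ[ r ∈ Ref k g ] suc (toℕ j) ≤ʳ r × node (gate j) ≈[ free ] (λ p → s xor node r p)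

  Essential : (Fin k → Bool) → Fin g → Set
  Essential free j = ¬ Degenerate free j

  degenerate? : ∀ free j → Dec (Degenerate free j)
  degenerate? free j = ∃-bool? λ s → ∃-ref? λ r → (suc (toℕ j) ≤ʳ? r) ×-dec
    ≈? free (refVal-extensional C (gate j))
            (λ eq → cong (s xor_) (refVal-extensional C r eq))

  essential? : ∀ free j → Dec (Essential free j)
  essential? free j = ¬? (degenerate? free j)

  essentialCount : (Fin k → Bool) → ℕ
  essentialCount free = count g (essential? free)

  degenerate-restrict : ∀ {free free'} → (∀ p → InCube free' p → InCube free p) →
                        ∀ {j} → Degenerate free j → Degenerate free' j
  degenerate-restrict shrink (s , r , r≤ , eq) = s , r , r≤ , λ p p∈ → eq p (shrink p p∈)

  degenerate-unary : ∀ {free j r} → suc (toℕ j) ≤ʳ r → (U : Bool → Bool) →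
                     node (gate j) ≈[ free ] (U ∘ node r) → Degenerate free j
  degenerate-unary {r = r} r≤ U eq with unary-cases U
  ... | inj₁ (b , U≡b) = false , const b , tt , λ p p∈ → trans (eq p p∈) (U≡b _)
  ... | inj₂ (s , U≡s) = s , r , r≤ , λ p p∈ → trans (eq p p∈) (U≡s _)

  data Reduced (free : Fin k → Bool) (lo : ℕ) : Ref k g → Set where
    input : ∀ i → Reduced free lo (input i)
    const : ∀ b → Reduced free lo (const b)
    gate  : ∀ {j} → Essential free j → lo ≤ toℕ j → Reduced free lo (gate j)

  reduced-mono : ∀ {free lo lo' r} → lo ≤ lo' → Reduced free lo' r → Reduced free lo r
  reduced-mono le (input i)     = input i
  reduced-mono le (const b)     = const b
  reduced-mono le (gate ess le') = gate ess (≤-trans le le')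

  reduced-≤ʳ : ∀ {free lo r} → Reduced free lo r → lo ≤ʳ r
  reduced-≤ʳ (input i)   = tt
  reduced-≤ʳ (const b)   = tt
  reduced-≤ʳ (gate _ le) = le

  Collapse : (Fin k → Bool) → ℕ → Ref k g → Set
  Collapse free lo r =
    Σ[ s ∈ Bool ] Σ[ r' ∈ Ref k g ] Reduced free lo r' × node r ≈[ free ] (λ p → s xor node r' p)

  collapse-gate : ∀ free j → Acc Fin._>_ j → Collapse free (toℕ j) (gate j)
  collapse-gate free j (acc rec) with degenerate? free j
  ... | no ess = false , gate j , gate ess ≤-refl , λ p _ → refl
  ... | yes (s , input i , _ , eq) = s , input i , input i , eq
  ... | yes (s , const b , _ , eq) = s , const b , const b , eq
  ... | yes (s , gate j' , j<j' , eq) with collapse-gate free j' (rec j<j')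
  ...   | s' , r , red , eq' = s xor s' , r , reduced-mono (<⇒≤ j<j') red , λ p p∈ →
            trans (eq p p∈) (trans (cong (s xor_) (eq' p p∈)) (sym (xor-assoc s s' (node r p))))

  collapse : ∀ free lo r → lo ≤ʳ r → Collapse free lo r
  collapse free lo (input i) _ = false , input i , input i , λ p _ → refl
  collapse free lo (const b) _ = false , const b , const b , λ p _ → refl
  collapse free lo (gate j) lo≤j with collapse-gate free j (>-wellFounded j)
  ... | s , r , red , eq = s , r , reduced-mono lo≤j red , eq

-- Eliminating two gates per fixed input

xor-cancelˡ : ∀ s b → s xor (s xor b) ≡ b
xor-cancelˡ s b = trans (sym (xor-assoc s s b)) (cong (_xor b) (xor-same s))

xor-transpose : ∀ {s a b} → a ≡ s xor b → b ≡ s xor a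
xor-transpose {s} {a} {b} a≡ = trans (sym (xor-cancelˡ s b)) (cong (s xor_) (sym a≡))

xor-injectiveˡ : ∀ s {a b} → s xor a ≡ s xor b → a ≡ b
xor-injectiveˡ s {a} {b} eq = trans (sym (xor-cancelˡ s a)) (trans (cong (s xor_) eq) (xor-cancelˡ s b))

Sensitive : (Bool → Bool → Bool) → Set
Sensitive G = G false true ≢ G true true × G true false ≢ G true true

∧-sensitive : Sensitive _∧_
∧-sensitive = (λ ()) , (λ ())

xor-sensitive : Sensitive _xor_
xor-sensitive = (λ ()) , (λ ())

module TwoGateElimination {k g : ℕ} (C : Circuit k g)
  (free free' : Fin k → Bool) (Y : Fin k)
  (free'⊆free : ∀ p → InCube free' p → InCube free p)
  (Y-free : free Y ≡ true)
  (Y-fixed : ∀ p → InCube free' p → p Y ≡ false)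
  (c : Assignment k → Bool)
  (c-ignores-Y : ∀ b → (λ p → c (updateAt p Y (λ _ → b))) ≈[ free ] c)
  (c-onto : ∀ v → Σ[ p ∈ Assignment k ] InCube free p × c p ≡ v)
  (and-out xor-out : Ref k g)
  (and-out-computes : ∀ p → InCube free p → refVal C p and-out ≡ (p Y ∧ c p))
  (xor-out-computes : ∀ p → InCube free p → refVal C p xor-out ≡ (p Y xor c p))
  where

  open GateElimination C

  set : Bool → Assignment k → Assignment k
  set b p = updateAt p Y (λ _ → b)

  set-Y : ∀ b p → set b p Y ≡ b
  set-Y b p = updateAt-updates Y p

  set-inCube : ∀ b p → InCube free p → InCube free (set b p)
  set-inCube b p p∈ l fixed with l ≟ Y
  ... | yes refl = contradiction (trans (sym Y-free) fixed) λ ()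
  ... | no l≢Y  = trans (updateAt-minimal l Y p l≢Y) (p∈ l fixed)

  set-cong : ∀ b {p q} → p ≗ q → set b p ≗ set b q
  set-cong b {p} {q} eq l with l ≟ Y
  ... | yes refl = trans (set-Y b p) (sym (set-Y b q))
  ... | no l≢Y  = trans (updateAt-minimal l Y p l≢Y) (trans (eq l) (sym (updateAt-minimal l Y q l≢Y)))

  IgnoresY : (Assignment k → Bool) → Set
  IgnoresY h = ∀ b → (λ p → h (set b p)) ≈[ free ] h

  ignoresY? : ∀ j → Dec (IgnoresY (node (gate j)))
  ignoresY? j = ∀-bool? λ b → ≈? free (λ eq → refVal-extensional C (gate j) (set-cong b eq))
                                      (refVal-extensional C (gate j))

  input-ignoresY : ∀ {l} → l ≢ Y → IgnoresY (node (input l))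
  input-ignoresY l≢Y b p _ = updateAt-minimal _ Y p l≢Y

  const-ignoresY : ∀ {b} → IgnoresY (node (const b))
  const-ignoresY _ _ _ = refl

  xor-ignoresY : ∀ s {h} → IgnoresY h → IgnoresY (λ p → s xor h p)
  xor-ignoresY s ign b p p∈ = cong (s xor_) (ign b p p∈)

  point : ∀ b v → Σ[ p ∈ Assignment k ] InCube free p × p Y ≡ b × c p ≡ v
  point b v with c-onto v
  ... | p , p∈ , cp≡v = set b p , set-inCube b p p∈ , set-Y b p , trans (c-ignores-Y b p p∈) cp≡v

  separate : ∀ (G H : Bool → Bool → Bool) →
             (∀ p → InCube free p → G (p Y) (c p) ≡ H (p Y) (c p)) → ∀ b v → G b v ≡ H b v
  separate G H eq b v with point b v
  ... | p , p∈ , pY≡b , cp≡v = trans (cong₂ G (sym pY≡b) (sym cp≡v)) (trans (eq p p∈) (cong₂ H pY≡b cp≡v))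

  ignoresY-separate : ∀ {h} (G : Bool → Bool → Bool) → IgnoresY h →
                      (∀ p → InCube free p → h p ≡ G (p Y) (c p)) → ∀ v → G false v ≡ G true v
  ignoresY-separate {h} G ign eq v with point true v
  ... | p , p∈ , pY≡true , cp≡v = begin
    G false v                        ≡⟨ cong₂ G (sym (set-Y false p)) (sym (trans (c-ignores-Y false p p∈) cp≡v)) ⟩
    G (set false p Y) (c (set false p)) ≡⟨ sym (eq _ (set-inCube false p p∈)) ⟩
    h (set false p)                  ≡⟨ ign false p p∈ ⟩
    h p                              ≡⟨ eq p p∈ ⟩
    G (p Y) (c p)                    ≡⟨ cong₂ G pY≡true cp≡v ⟩
    G true v                         ∎
    where open ≡-Reasoning

  GateComputing : (Bool → Bool → Bool) → Set
  GateComputing G = Σ[ s ∈ Bool ] Σ[ S ∈ Fin g ]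
    Essential free S × (∀ p → InCube free p → node (gate S) p ≡ s xor G (p Y) (c p))

  essential-gate-computing : ∀ G r → Sensitive G →
    (∀ p → InCube free p → node r p ≡ G (p Y) (c p)) → GateComputing G
  essential-gate-computing G r (Y-matters , c-matters) computes with collapse free 0 r (0≤ʳ r)
  ... | s , r' , red , eq = settle red λ p p∈ → trans (sym (computes p p∈)) (eq p p∈)
    where
    Y-matters-for : ∀ r' → IgnoresY (node r') → ¬ (∀ p → InCube free p → G (p Y) (c p) ≡ s xor node r' p)
    Y-matters-for r' ign eq' = Y-matters
      (ignoresY-separate G (xor-ignoresY s ign) (λ p p∈ → sym (eq' p p∈)) true)

    settle : ∀ {r'} → Reduced free 0 r' → (∀ p → InCube free p → G (p Y) (c p) ≡ s xor node r' p) →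
             GateComputing G
    settle (input l) eq' with l ≟ Y
    ... | yes refl = contradiction (trans (by-Y true false) (sym (by-Y true true))) c-matters
      where by-Y = separate G (λ y _ → s xor y) eq'
    ... | no l≢Y  = contradiction eq' (Y-matters-for (input l) (input-ignoresY l≢Y))
    settle (const b) eq' = contradiction eq' (Y-matters-for (const b) const-ignoresY)
    settle (gate {S} ess _) eq' = s , S , ess , λ p p∈ → xor-transpose {s} (eq' p p∈)

  DependsOnY : Fin g → Set
  DependsOnY j = Essential free j × ¬ IgnoresY (node (gate j))

  dependsOnY? : ∀ j → Dec (DependsOnY j)
  dependsOnY? j = essential? free j ×-dec ¬? (ignoresY? j)

  computing-dependsOnY : ∀ G → Sensitive G → ((s , S , _) : GateComputing G) → ¬ IgnoresY (node (gate S))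
  computing-dependsOnY G (Y-matters , _) (s , S , _ , computes) ign =
    Y-matters (xor-injectiveˡ s (ignoresY-separate (λ y v → s xor G y v) ign computes true))

  Eliminated : Fin g → Set
  Eliminated j = Essential free j × Degenerate free' j

  AndGate : Bool → Fin g → Set
  AndGate s S = ∀ p → InCube free p → node (gate S) p ≡ s xor (p Y ∧ c p)

  and-gate-eliminated : ∀ s {S} → AndGate s S → Degenerate free' S
  and-gate-eliminated s and = false , const (s xor false) , tt , λ p p∈ →
    trans (and p (free'⊆free p p∈)) (cong (λ y → s xor (y ∧ c p)) (Y-fixed p p∈))

  module Earliest (A : Fin g) (A-dep : DependsOnY A) (A-earliest : ∀ j → A Fin.< j → ¬ DependsOnY j) where

    reduced-ignoresY : ∀ {r} → Reduced free (suc (toℕ A)) r → r ≡ input Y ⊎ IgnoresY (node r)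
    reduced-ignoresY (input l) with l ≟ Y
    ... | yes refl = inj₁ refl
    ... | no l≢Y  = inj₂ (input-ignoresY l≢Y)
    reduced-ignoresY (const b) = inj₂ const-ignoresY
    reduced-ignoresY (gate {j} ess A<j) with ignoresY? j
    ... | yes ign = inj₂ ign
    ... | no dep  = contradiction (ess , dep) (A-earliest j A<j)

    BinaryInY : Set
    BinaryInY = Σ[ B ∈ (Bool → Bool → Bool) ] Σ[ r ∈ Ref k g ] Reduced free (suc (toℕ A)) r ×
                  (∀ p → InCube free p → node (gate A) p ≡ B (p Y) (node r p))

    binaryInY : BinaryInY
    binaryInY with gate-inputs C A
    ... | op , a , b , a≤ , b≤ , computes
        with collapse free (suc (toℕ A)) a a≤ | collapse free (suc (toℕ A)) b b≤
    ...   | sa , ra , reda , eqa | sb , rb , redb , eqb =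
          combine (reduced-ignoresY reda) (reduced-ignoresY redb) reda redb
      where
      via : ∀ p → InCube free p → node (gate A) p ≡ op (sa xor node ra p) (sb xor node rb p)
      via p p∈ = trans (computes p) (cong₂ op (eqa p p∈) (eqb p p∈))

      combine : ra ≡ input Y ⊎ IgnoresY (node ra) → rb ≡ input Y ⊎ IgnoresY (node rb) →
                Reduced free (suc (toℕ A)) ra → Reduced free (suc (toℕ A)) rb → BinaryInY
      combine (inj₁ refl) _ _ redb = (λ y v → op (sa xor y) (sb xor v)) , rb , redb , via
      combine (inj₂ _) (inj₁ refl) reda _ = (λ y v → op (sa xor v) (sb xor y)) , ra , reda , via
      combine (inj₂ ia) (inj₂ ib) _ _ = contradiction ignores (proj₂ A-dep)
        where
        ignores : IgnoresY (node (gate A))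
        ignores y p p∈ = begin
          node (gate A) (set y p)                                  ≡⟨ via _ (set-inCube y p p∈) ⟩
          op (sa xor node ra (set y p)) (sb xor node rb (set y p)) ≡⟨ cong₂ (λ u v → op (sa xor u) (sb xor v)) (ia y p p∈) (ib y p p∈) ⟩
          op (sa xor node ra p) (sb xor node rb p)                 ≡⟨ via p p∈ ⟨
          node (gate A) p                                          ∎
          where open ≡-Reasoning

    A-eliminated : Degenerate free' A
    A-eliminated with binaryInY
    ... | B , r , red , computes = degenerate-unary (reduced-≤ʳ red) (B false) λ p p∈ →
          trans (computes p (free'⊆free p p∈)) (cong (λ y → B y (node r p)) (Y-fixed p p∈))

    -- If A itself computes the and-bit, then c = s ⊕ B 1 h for the second argument h of A, which
    -- ignores Y; the gate T computing the xor-bit comes after A, so fixing Y = 0 makes T unary in h.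
    and-at-A : ∀ s → AndGate s A → Σ[ T ∈ Fin g ] A ≢ T × Eliminated T
    and-at-A s A-and with binaryInY | essential-gate-computing _xor_ xor-out xor-sensitive xor-out-computes
    ... | B , r , red , B-computes | T-gate@(t , T , T-ess , T-xor) = T , A≢T , T-ess , T-eliminated
      where
      B-and : ∀ p → InCube free p → B (p Y) (node r p) ≡ s xor (p Y ∧ c p)
      B-and p p∈ = trans (sym (B-computes p p∈)) (A-and p p∈)

      r-ignoresY : r ≡ input Y ⊎ IgnoresY (node r) → IgnoresY (node r)
      r-ignoresY (inj₂ ign) = ign
      r-ignoresY (inj₁ r≡Y) = contradiction (xor-injectiveˡ s (trans (sym (both true false)) (both true true))) λ ()
        where
        both = separate (λ y _ → B y y) (λ y v → s xor (y ∧ v))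
                 (λ p p∈ → trans (cong (B (p Y)) (sym (cong (λ r → node r p) r≡Y))) (B-and p p∈))

      B-true : ∀ p → InCube free p → B true (node r p) ≡ s xor c p
      B-true p p∈ = begin
        B true (node r p)                       ≡⟨ cong₂ B (sym (set-Y true p)) (sym (r-ignoresY (reduced-ignoresY red) true p p∈)) ⟩
        B (set true p Y) (node r (set true p))  ≡⟨ B-and _ (set-inCube true p p∈) ⟩
        s xor (set true p Y ∧ c (set true p))   ≡⟨ cong₂ (λ y v → s xor (y ∧ v)) (set-Y true p) (c-ignores-Y true p p∈) ⟩
        s xor c p                               ∎
        where open ≡-Reasoning

      A≢T : A ≢ T
      A≢T refl = contradiction (xor-injectiveˡ t (trans (same false false) (sym (same false true)))) λ ()
        where
        same = separate (λ y v → t xor (y xor v)) (λ y v → s xor (y ∧ v))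
                 (λ p p∈ → trans (sym (T-xor p p∈)) (A-and p p∈))

      T<A : T Fin.< A
      T<A = ≤∧≢⇒< (≮⇒≥ λ A<T → A-earliest T A<T (T-ess , computing-dependsOnY _xor_ xor-sensitive T-gate))
                  (λ T≡A → A≢T (sym T≡A))

      T-eliminated : Degenerate free' T
      T-eliminated = degenerate-unary (≤ʳ-trans (m≤n⇒m≤1+n T<A) r (reduced-≤ʳ red))
        (λ v → t xor (s xor B true v)) λ p p∈ →
          trans (T-xor p (free'⊆free p p∈))
                (trans (cong (λ y → t xor (y xor c p)) (Y-fixed p p∈))
                       (cong (t xor_) (xor-transpose {s} (B-true p (free'⊆free p p∈)))))

    eliminated-pair : ∀ s {S} → Essential free S → AndGate s S →
              Σ[ i ∈ Fin g ] Σ[ j ∈ Fin g ] i ≢ j × Eliminated i × Eliminated j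
    eliminated-pair s {S} S-ess S-and with A ≟ S
    ... | no A≢S  = A , S , A≢S , (proj₁ A-dep , A-eliminated) , (S-ess , and-gate-eliminated s S-and)
    ... | yes refl with and-at-A s S-and
    ...   | T , A≢T , T-eliminated = A , T , A≢T , (proj₁ A-dep , A-eliminated) , T-eliminated

  two-gates-eliminated : Σ[ i ∈ Fin g ] Σ[ j ∈ Fin g ] i ≢ j × Eliminated i × Eliminated j
  two-gates-eliminated with essential-gate-computing _∧_ and-out ∧-sensitive and-out-computes
  ... | S-gate@(s , S , S-ess , S-and)
      with maximal-witness dependsOnY? (S-ess , computing-dependsOnY _∧_ ∧-sensitive S-gate)
  ...   | A , A-dep , A-earliest = Earliest.eliminated-pair A A-dep A-earliest s S-ess S-and

  essentialCount-drops : 2 + essentialCount free' ≤ essentialCount free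
  essentialCount-drops with two-gates-eliminated
  ... | i , j , i≢j , (ess-i , deg-i) , (ess-j , deg-j) =
    count-gap₂ g (essential? free) (essential? free')
      (λ _ ess' deg → ess' (degenerate-restrict free'⊆free deg))
      i j i≢j ess-i (λ ess' → ess' deg-i) ess-j (λ ess' → ess' deg-j)

-- The bit adder

weightedSum-sig : ∀ n p → weightedSum (sig n) p ≡ rippleValue n (p zero) (tail p)
weightedSum-sig n p = cong (_+ sumFin n (λ i → 2 ^ toℕ i * bval (p (suc i)))) (*-identityˡ (bval (p zero)))

level : ∀ {n} → ℕ → Fin (suc n) → Bool
level r zero    = true
level r (suc i) = does (toℕ i <? r)

level-mono : ∀ {n} r (l : Fin (suc n)) → level (suc r) l ≡ false → level r l ≡ false
level-mono r zero    ()
level-mono r (suc i) fixed = dec-false (toℕ i <? r) λ i<r →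
  contradiction (trans (sym (dec-true (toℕ i <? suc r) (m<n⇒m<1+n i<r))) fixed) λ ()

module AdderCircuit (n g : ℕ) (C : Circuit (suc n) g) (out : Fin (suc n) → Ref (suc n) g)
                    (computes : Computes C out (BA n)) where

  open GateElimination C

  output-bit : ∀ p j → refVal C p (out j) ≡ digit n (tail p) (toℕ j) xor carry n (p zero) (tail p) (toℕ j)
  output-bit p j = begin
    refVal C p (out j)                                   ≡⟨ computes p j ⟩
    bit (weightedSum (sig n) p) (toℕ j)                  ≡⟨ cong (λ v → bit v (toℕ j)) (weightedSum-sig n p) ⟩
    bit (rippleValue n (p zero) (tail p)) (toℕ j)        ≡⟨ bit-rippleValue n (p zero) (tail p) (toℕ j) ⟩
    digit n (tail p) (toℕ j) xor carry n (p zero) (tail p) (toℕ j) ∎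
    where open ≡-Reasoning

  module Level (r : ℕ) (r<n : r < n) where

    y : Fin n
    y = fromℕ< r<n

    toℕ-y : toℕ y ≡ r
    toℕ-y = toℕ-fromℕ< r<n

    Y : Fin (suc n)
    Y = suc y

    Y-free : level (suc r) Y ≡ true
    Y-free = dec-true (toℕ y <? suc r) (≤-reflexive (cong suc toℕ-y))

    Y-fixed : ∀ p → InCube (level r) p → p Y ≡ false
    Y-fixed p p∈ = p∈ Y (dec-false (toℕ y <? r) (<-irrefl toℕ-y))

    carry-r : Assignment (suc n) → Bool
    carry-r p = carry n (p zero) (tail p) r

    carry-ignores-Y : ∀ b → (λ p → carry-r (updateAt p Y (λ _ → b))) ≈[ level (suc r) ] carry-r
    carry-ignores-Y b p _ = carry-cong n (p zero) {updateAt (tail p) y (λ _ → b)} {tail p} r λ i i<r →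
      updateAt-minimal i y (tail p) (λ i≡y → <-irrefl (trans (cong toℕ i≡y) toℕ-y) i<r)

    carry-onto : ∀ v → Σ[ p ∈ Assignment (suc n) ] InCube (level (suc r)) p × carry-r p ≡ v
    carry-onto false = (λ _ → false) , (λ _ _ → refl) , carry-false n (λ _ → false) r
    carry-onto true  = level (suc r) , (λ _ fixed → fixed) ,
      carry-ones n (tail (level (suc r))) r (<⇒≤ r<n) (λ i i<r → dec-true (toℕ i <? suc r) (m<n⇒m<1+n i<r))

    digit-r : ∀ p → digit n (tail p) r ≡ p Y
    digit-r p = trans (cong (digit n (tail p)) (sym toℕ-y)) (digit-toℕ n (tail p) y)

    and-out-computes : ∀ p → InCube (level (suc r)) p → refVal C p (out Y) ≡ (p Y ∧ carry-r p)
    and-out-computes p p∈ = begin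
      refVal C p (out Y)                                          ≡⟨ output-bit p Y ⟩
      digit n (tail p) (suc (toℕ y)) xor carry n (p zero) (tail p) (suc (toℕ y))
        ≡⟨ cong (λ j → digit n (tail p) (suc j) xor carry n (p zero) (tail p) (suc j)) toℕ-y ⟩
      digit n (tail p) (suc r) xor carry n (p zero) (tail p) (suc r)
        ≡⟨ cong₂ _xor_ (digit-vanishes n (tail p) (suc r) beyond) (carry-suc n (p zero) (tail p) r) ⟩
      digit n (tail p) r ∧ carry-r p                              ≡⟨ cong (_∧ carry-r p) (digit-r p) ⟩
      p Y ∧ carry-r p                                             ∎
      where
      open ≡-Reasoning
      beyond : ∀ i → suc r ≤ toℕ i → tail p i ≡ false
      beyond i r<i = p∈ (suc i) (dec-false (toℕ i <? suc r) (≤⇒≯ r<i))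

    xor-out-computes : ∀ p → InCube (level (suc r)) p → refVal C p (out (inject₁ y)) ≡ (p Y xor carry-r p)
    xor-out-computes p _ = begin
      refVal C p (out (inject₁ y))                        ≡⟨ output-bit p (inject₁ y) ⟩
      digit n (tail p) (toℕ (inject₁ y)) xor carry n (p zero) (tail p) (toℕ (inject₁ y))
        ≡⟨ cong (λ j → digit n (tail p) j xor carry n (p zero) (tail p) j) (trans (toℕ-inject₁ y) toℕ-y) ⟩
      digit n (tail p) r xor carry-r p                    ≡⟨ cong (_xor carry-r p) (digit-r p) ⟩
      p Y xor carry-r p                                   ∎
      where open ≡-Reasoning

    open TwoGateElimination C (level (suc r)) (level r) Y (λ p p∈ l fixed → p∈ l (level-mono r l fixed))
      Y-free Y-fixed carry-r carry-ignores-Y carry-onto (out Y) (out (inject₁ y))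
      and-out-computes xor-out-computes public using (essentialCount-drops)

  essentialCount-level : ∀ r → r ≤ n → 2 * r ≤ essentialCount (level r)
  essentialCount-level zero    _   = z≤n
  essentialCount-level (suc r) r<n = begin
    2 * suc r                        ≡⟨ *-suc 2 r ⟩
    2 + 2 * r                        ≤⟨ +-monoʳ-≤ 2 (essentialCount-level r (<⇒≤ r<n)) ⟩
    2 + essentialCount (level r)     ≤⟨ Level.essentialCount-drops r r<n ⟩
    essentialCount (level (suc r))   ∎
    where open ≤-Reasoning

  size-≥-2n : 2 * n ≤ g
  size-≥-2n = ≤-trans (essentialCount-level n ≤-refl) (count-≤ g (essential? (level n)))

theorem2 : ∃[ c ] ∀ (n g : ℕ) (C : Circuit (suc n) g) (out : Fin (suc n) → Ref (suc n) g)
             → Computes C out (BA n) → 2 * n ≤ g + c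
theorem2 = 0 , λ n g C out computes → ≤-trans (AdderCircuit.size-≥-2n n g C out computes) (m≤m+n g 0)
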